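{- For all integers $d\ge0$ and $0\le l\le d$, \[B_{l+1}(d+1,t)=2^l\sum_{j=0}^{d-l}\binom{d-l}{j}A_{j+l+1}(d+1,t).\]
   Context: For $\sigma\in S_m$, $\operatorname{des}(\sigma)=|\{i\in[m-1]:\sigma_i>\sigma_{i+1}\}|$ and $A_j(m,t)=\sum_{\sigma\in S_m,\ \sigma_m=m+1-j}t^{\operatorname{des}(\sigma)}$ for $1\le j\le m$. A signed permutation of $[m]$ is a pair $(\sigma,\epsilon)$ with $\sigma\in S_m$, $\epsilon\in\{\pm1\}^m$; $B_m$ is the set of these. Set $\sigma_0=0$, $\epsilon_0=1$. The descent set is $\operatorname{Des}(\sigma,\epsilon)=\{i\in\{0,1,\dots,m-1\}:\epsilon_i\sigma_i>\epsilon_{i+1}\sigma_{i+1}\}$ and $\operatorname{des}(\sigma,\epsilon)=|\operatorname{Des}(\sigma,\epsilon)|$. For $1\le l\le m$, $B_l(m,t)=\sum t^{\operatorname{des}(\sigma,\epsilon)}$, the sum over $(\sigma,\epsilon)\in B_m$ with $\epsilon_m\sigma_m=m+1-l$. -}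

module Defs where

open import Data.Nat as ℕ using (ℕ; zero; suc; _∸_)
open import Data.Integer as ℤ using (ℤ; +_; -_; ∣_∣)
open import Data.Bool using (Bool; true; false)
open import Data.List using (List; []; _∷_; map; concatMap; upTo; filter; length; _++_)
open import Data.Maybe using (Maybe; just; nothing)
open import Relation.Nullary using (does)
import Data.List.Relation.Unary.Unique.DecPropositional as UniqueDec

range : ℕ → List ℕ
range m = map suc (upTo m)

words : {A : Set} → ℕ → List A → List (List A)
words zero xs = [] ∷ []
words (suc n) xs = concatMap (λ x → map (x ∷_) (words n xs)) xs

-- S_m : permutations of [m] in one-line notation σ₁…σₘ
-- (words of length m over [m] with pairwise distinct letters)
Sym : ℕ → List (List ℕ)
Sym m = filter (UniqueDec.unique? ℕ._≟_) (words m (range m))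

-- B_m : signed permutations, written as the word ε₁σ₁ … εₘσₘ of
-- nonzero integers whose absolute values form a permutation of [m]
SignedPerms : ℕ → List (List ℤ)
SignedPerms m =
  filter (λ w → UniqueDec.unique? ℕ._≟_ (map ∣_∣ w))
         (words m (map +_ (range m) ++ map (λ k → - (+ k)) (range m)))

ind : Bool → ℕ
ind true = 1
ind false = 0

desℕ : List ℕ → ℕ
desℕ (x ∷ rest@(y ∷ w)) = ind (does (y ℕ.<? x)) ℕ.+ desℕ rest
desℕ _ = 0

desℤ : List ℤ → ℕ
desℤ (x ∷ rest@(y ∷ w)) = ind (does (y ℤ.<? x)) ℕ.+ desℤ rest
desℤ _ = 0

desS : List ℕ → ℕ
desS = desℕ

desB : List ℤ → ℕ
desB w = desℤ (+ 0 ∷ w)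

lastIsℕ : ℕ → List ℕ → Bool
lastIsℕ v w with Data.List.last w
... | just x  = does (x ℕ.≟ v)
... | nothing = false
  where import Data.List

lastIsℤ : ℤ → List ℤ → Bool
lastIsℤ v w with Data.List.last w
... | just x  = does (x ℤ.≟ v)
... | nothing = false
  where import Data.List

countᵇ : {A : Set} → (A → Bool) → List A → ℕ
countᵇ p [] = 0
countᵇ p (x ∷ xs) with p x
... | true  = suc (countᵇ p xs)
... | false = countᵇ p xs

-- Polynomials in t with ℕ coefficients are represented by their
-- coefficient sequence ℕ → ℕ.  coeffA j m k = [t^k] A_j(m,t):
-- number of σ ∈ S_m with σ_m = m+1-j and des σ = k.
coeffA : ℕ → ℕ → ℕ → ℕ
coeffA j m k =
  countᵇ (λ σ → Data.Bool._∧_ (lastIsℕ (suc m ∸ j) σ) (does (desS σ ℕ.≟ k))) (Sym m)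
  where import Data.Bool

-- coeffB l m k = [t^k] B_l(m,t):
-- number of (σ,ε) ∈ B_m with ε_mσ_m = m+1-l and des (σ,ε) = k.
coeffB : ℕ → ℕ → ℕ → ℕ
coeffB l m k =
  countᵇ (λ w → Data.Bool._∧_ (lastIsℤ (+ (suc m ∸ l)) w) (does (desB w ℕ.≟ k))) (SignedPerms m)
  where import Data.Bool

sumTo : ℕ → (ℕ → ℕ) → ℕ
sumTo zero f = f 0
sumTo (suc n) f = sumTo n f ℕ.+ f (suc n)

-- A signed permutation ending in +v is a signing T of [1..m] (a choice of sign for each
-- value) together with an arrangement of its letters. Relabelling each letter by its rank
-- in the order on T that keeps the order within each sign but puts the negative letters
-- above the nonnegative ones turns the arrangements of T into permutations of [m] without
-- changing the number of descents: adjacent letters of different signs swap their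
-- comparison, and these swaps cancel telescopically because the word starts (σ₀ = 0) and
-- ends (+v) with a nonnegative letter. The rank of +v is v minus the number j of negative
-- letters of T below v, so with v = d + 1 − l the signing contributes A_{j+l+1}(d+1, t).
-- The l letters above v may carry either sign, giving 2^l, and the d − l letters below v
-- carry exactly j minus signs in C(d − l, j) ways.
module Submission where

open import Data.Bool using (Bool; true; false; _∧_; not)
open import Data.Bool.Properties using (∧-assoc; ∧-zeroʳ)
open import Data.Integer as ℤ using (ℤ; +_; -_; -[1+_]; ∣_∣)
open import Data.Integer.Properties using (∣-i∣≡∣i∣; drop‿+<+; drop‿-<-)
open import Data.Nat as ℕ using (ℕ; zero; suc; _+_; _*_; _∸_; _^_; _≤_; _<_; _<?_; z≤n; s≤s)
open import Data.List using (List; []; _∷_; map; concatMap; filter; length; _++_; last; applyUpTo)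
open import Data.List.Membership.DecPropositional ℕ._≟_ using (_∈?_)
open import Data.List.Membership.Propositional using (_∈_; _∉_)
open import Data.List.Membership.Propositional.Properties using (∈-map⁺; ∈-map⁻; ∈-++⁻; ∈-++⁺ʳ; ∈-filter⁺)
open import Data.List.Membership.Propositional.Properties.WithK using (unique∧set⇒bag)
open import Data.List.Properties
  using (length-map; map-++; map-∘; map-cong-local; filter-accept; filter-reject; filter-all; filter-notAll)
open import Data.List.Relation.Binary.BagAndSetEquality using (∼bag⇒↭)
open import Data.List.Relation.Binary.Permutation.Propositional using (_↭_; ↭-refl; ↭-trans; prep)
import Data.List.Relation.Binary.Permutation.Propositional.Properties as ↭
open import Data.List.Relation.Binary.Subset.Propositional using (_⊆_)
open import Data.List.Relation.Unary.All as All using (All; []; _∷_)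
import Data.List.Relation.Unary.All.Properties as AllP
open import Data.List.Relation.Unary.AllPairs using ([]; _∷_)
open import Data.List.Relation.Unary.Any as Any using (here; there)
open import Data.List.Relation.Unary.Unique.Propositional using (Unique)
import Data.List.Relation.Unary.Unique.Propositional.Properties as Unique
import Data.List.Relation.Unary.Unique.DecPropositional as UniqueDec
open import Data.Maybe using (just)
open import Data.Nat.Combinatorics using (_C_; nCk+nC[k+1]≡[n+1]C[k+1]; k>n⇒nCk≡0)
open import Data.Nat.ListAction using (sum)
open import Data.Nat.ListAction.Properties using (sum-++; sum-↭)
open import Data.Nat.Properties
open import Data.Nat.Tactic.RingSolver using (solve-∀)
open import Data.Product using (_×_; _,_; proj₁; proj₂)
open import Data.Sum using (inj₁; inj₂)
open import Data.Unit using (tt)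
open import Function using (id; _∘_; _⟨_⟩_)
open import Function.Bundles using (_⇔_; mk⇔)
open import Relation.Binary.Definitions using (tri<; tri≈; tri>)
open import Relation.Binary.PropositionalEquality
  using (_≡_; _≢_; refl; sym; trans; cong; cong₂; subst; subst₂; module ≡-Reasoning)
open import Relation.Nullary using (Dec; does; yes; no; ¬_; ¬?; contradiction)
open import Relation.Nullary.Decidable using (dec-true; dec-false; does-⇔)
open import Relation.Unary using (Decidable)

open import Defs

open import Algebra.Properties.CommutativeSemigroup +-commutativeSemigroup
  using () renaming ( interchange to +-interchange; x∙yz≈y∙xz to x+[y+z]≡y+[x+z]
                    ; xy∙z≈xz∙y to [x+y]+z≡[x+z]+y; x∙yz≈xz∙y to x+[y+z]≡[x+z]+y)

∑ : {A : Set} → List A → (A → ℕ) → ℕ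
∑ xs f = sum (map f xs)

∑-++ : {A : Set} (xs ys : List A) (f : A → ℕ) → ∑ (xs ++ ys) f ≡ ∑ xs f + ∑ ys f
∑-++ xs ys f = trans (cong sum (map-++ f xs ys)) (sum-++ (map f xs) (map f ys))

∑-map : {A B : Set} (g : A → B) (xs : List A) (f : B → ℕ) → ∑ (map g xs) f ≡ ∑ xs (f ∘ g)
∑-map g xs f = cong sum (sym (map-∘ xs))

∑-cong : {A : Set} (xs : List A) {f g : A → ℕ} → (∀ {x} → x ∈ xs → f x ≡ g x) → ∑ xs f ≡ ∑ xs g
∑-cong xs f≡g = cong sum (map-cong-local (All.tabulate f≡g))

∑-+ : {A : Set} (xs : List A) (f g : A → ℕ) → ∑ xs (λ x → f x + g x) ≡ ∑ xs f + ∑ xs g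
∑-+ [] f g = refl
∑-+ (x ∷ xs) f g = trans (cong (_+_ (f x + g x)) (∑-+ xs f g)) (+-interchange (f x) (g x) _ _)

∑-*ˡ : {A : Set} (xs : List A) (c : ℕ) (f : A → ℕ) → ∑ xs (λ x → c * f x) ≡ c * ∑ xs f
∑-*ˡ [] c f = sym (*-zeroʳ c)
∑-*ˡ (x ∷ xs) c f = trans (cong (_+_ (c * f x)) (∑-*ˡ xs c f)) (sym (*-distribˡ-+ c (f x) (∑ xs f)))

∑-↭ : {A : Set} {xs ys : List A} (f : A → ℕ) → xs ↭ ys → ∑ xs f ≡ ∑ ys f
∑-↭ f xs↭ys = sum-↭ (↭.map⁺ f xs↭ys)

∑-mono-≤ : {A : Set} (xs : List A) {f g : A → ℕ} → (∀ {x} → x ∈ xs → f x ≤ g x) → ∑ xs f ≤ ∑ xs g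
∑-mono-≤ [] f≤g = z≤n
∑-mono-≤ (x ∷ xs) f≤g = +-mono-≤ (f≤g (here refl)) (∑-mono-≤ xs (f≤g ∘ there))

∑-mono-< : {A : Set} (xs : List A) {f g : A → ℕ} → (∀ {x} → x ∈ xs → f x ≤ g x) →
  ∀ {b} → b ∈ xs → f b < g b → ∑ xs f < ∑ xs g
∑-mono-< (x ∷ xs) f≤g (here refl) fb<gb = +-mono-<-≤ fb<gb (∑-mono-≤ xs (f≤g ∘ there))
∑-mono-< (x ∷ xs) f≤g (there b∈) fb<gb = +-mono-≤-< (f≤g (here refl)) (∑-mono-< xs (f≤g ∘ there) b∈ fb<gb)

countᵇ≡∑ : {A : Set} (p : A → Bool) (xs : List A) → countᵇ p xs ≡ ∑ xs (ind ∘ p)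
countᵇ≡∑ p [] = refl
countᵇ≡∑ p (x ∷ xs) with p x
... | true = cong suc (countᵇ≡∑ p xs)
... | false = countᵇ≡∑ p xs

countᵇ-++ : {A : Set} (p : A → Bool) (xs ys : List A) → countᵇ p (xs ++ ys) ≡ countᵇ p xs + countᵇ p ys
countᵇ-++ p xs ys = begin
  countᵇ p (xs ++ ys)             ≡⟨ countᵇ≡∑ p (xs ++ ys) ⟩
  ∑ (xs ++ ys) (ind ∘ p)          ≡⟨ ∑-++ xs ys (ind ∘ p) ⟩
  ∑ xs (ind ∘ p) + ∑ ys (ind ∘ p) ≡⟨ sym (cong₂ _+_ (countᵇ≡∑ p xs) (countᵇ≡∑ p ys)) ⟩
  countᵇ p xs + countᵇ p ys       ∎
  where open ≡-Reasoning

countᵇ-map : {A B : Set} (p : B → Bool) (g : A → B) (xs : List A) → countᵇ p (map g xs) ≡ countᵇ (p ∘ g) xs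
countᵇ-map p g xs = trans (countᵇ≡∑ p (map g xs)) (trans (∑-map g xs (ind ∘ p)) (sym (countᵇ≡∑ (p ∘ g) xs)))

countᵇ-concatMap : {A B : Set} (p : B → Bool) (f : A → List B) (xs : List A) →
  countᵇ p (concatMap f xs) ≡ ∑ xs (λ x → countᵇ p (f x))
countᵇ-concatMap p f [] = refl
countᵇ-concatMap p f (x ∷ xs) = trans (countᵇ-++ p (f x) (concatMap f xs)) (cong (_+_ (countᵇ p (f x))) (countᵇ-concatMap p f xs))

countᵇ-filter : {A : Set} {P : A → Set} (P? : Decidable P) (p : A → Bool) (xs : List A) →
  countᵇ p (filter P? xs) ≡ countᵇ (λ x → does (P? x) ∧ p x) xs
countᵇ-filter P? p [] = refl
countᵇ-filter P? p (x ∷ xs) with does (P? x)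
... | false = countᵇ-filter P? p xs
... | true with p x
...   | true = cong suc (countᵇ-filter P? p xs)
...   | false = countᵇ-filter P? p xs

countᵇ-cong : {A : Set} {p q : A → Bool} (xs : List A) → (∀ {x} → x ∈ xs → p x ≡ q x) → countᵇ p xs ≡ countᵇ q xs
countᵇ-cong xs p≡q = trans (countᵇ≡∑ _ xs) (trans (∑-cong xs (cong ind ∘ p≡q)) (sym (countᵇ≡∑ _ xs)))

countᵇ-const-false : {A : Set} (xs : List A) → countᵇ (λ _ → false) xs ≡ 0
countᵇ-const-false [] = refl
countᵇ-const-false (_ ∷ xs) = countᵇ-const-false xs

countᵇ-true : {A : Set} (xs : List A) → countᵇ (λ _ → true) xs ≡ length xs
countᵇ-true [] = refl
countᵇ-true (x ∷ xs) = cong suc (countᵇ-true xs)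

countᵇ-not+countᵇ : {A : Set} (p : A → Bool) (xs : List A) → countᵇ (not ∘ p) xs + countᵇ p xs ≡ length xs
countᵇ-not+countᵇ p [] = refl
countᵇ-not+countᵇ p (x ∷ xs) with p x
... | true = trans (+-suc _ _) (cong suc (countᵇ-not+countᵇ p xs))
... | false = cong suc (countᵇ-not+countᵇ p xs)

ind-does-mono : {P Q : Set} (P? : Dec P) (Q? : Dec Q) → (P → Q) → ind (does P?) ≤ ind (does Q?)
ind-does-mono (yes p) (yes q) _ = ≤-refl
ind-does-mono (yes p) (no ¬q) P→Q = contradiction (P→Q p) ¬q
ind-does-mono (no _) Q? _ = z≤n

countᵇ-does-< : {A : Set} {P Q : A → Set} (P? : Decidable P) (Q? : Decidable Q) (xs : List A) →
  (∀ {x} → x ∈ xs → P x → Q x) → ∀ {b} → b ∈ xs → ¬ P b → Q b →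
  countᵇ (does ∘ P?) xs < countᵇ (does ∘ Q?) xs
countᵇ-does-< P? Q? xs P⇒Q {b} b∈ ¬Pb Qb =
  subst₂ _<_ (sym (countᵇ≡∑ (does ∘ P?) xs)) (sym (countᵇ≡∑ (does ∘ Q?) xs))
    (∑-mono-< xs (λ {x} x∈ → ind-does-mono (P? x) (Q? x) (P⇒Q x∈)) b∈
      (subst₂ (λ i j → ind i < ind j) (sym (dec-false (P? b) ¬Pb)) (sym (dec-true (Q? b) Qb)) ≤-refl))

Unique-map⁺ : {A B : Set} {f : A → B} (xs : List A) → (∀ {a b} → a ∈ xs → b ∈ xs → f a ≡ f b → a ≡ b) →
  Unique xs → Unique (map f xs)
Unique-map⁺ [] f-inj [] = []
Unique-map⁺ (x ∷ xs) f-inj (x∉xs ∷ u) =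
  AllP.map⁺ (All.tabulate (λ y∈ fx≡fy → All.lookup x∉xs y∈ (f-inj (here refl) (there y∈) fx≡fy)))
  ∷ Unique-map⁺ xs (λ a∈ b∈ → f-inj (there a∈) (there b∈)) u

Unique-map⇒injectiveOn : {A B : Set} (f : A → B) (xs : List A) → Unique (map f xs) →
  ∀ {a b} → a ∈ xs → b ∈ xs → f a ≡ f b → a ≡ b
Unique-map⇒injectiveOn f (x ∷ xs) _ (here refl) (here refl) _ = refl
Unique-map⇒injectiveOn f (x ∷ xs) (fx∉ ∷ _) (here refl) (there b∈) fx≡fb = contradiction fx≡fb (All.lookup fx∉ (∈-map⁺ f b∈))
Unique-map⇒injectiveOn f (x ∷ xs) (fx∉ ∷ _) (there a∈) (here refl) fa≡fx = contradiction (sym fa≡fx) (All.lookup fx∉ (∈-map⁺ f a∈))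
Unique-map⇒injectiveOn f (x ∷ xs) (_ ∷ u) (there a∈) (there b∈) fa≡fb = Unique-map⇒injectiveOn f xs u a∈ b∈ fa≡fb

does-unique?-map-cong : {A : Set} {X : List A} (f g : A → ℕ) →
  (∀ {a b} → a ∈ X → b ∈ X → (f a ≡ f b) ⇔ (g a ≡ g b)) →
  ∀ w → All (_∈ X) w → does (UniqueDec.unique? ℕ._≟_ (map f w)) ≡ does (UniqueDec.unique? ℕ._≟_ (map g w))
does-unique?-map-cong f g same-eq [] _ = refl
does-unique?-map-cong {A} {X} f g same-eq (a ∷ w) (a∈ ∷ w⊆X) =
  cong₂ _∧_ (head-fresh w w⊆X) (does-unique?-map-cong f g same-eq w w⊆X)
  where
  head-fresh : ∀ u → All (_∈ X) u →
    does (All.all? (λ y → ¬? (f a ℕ.≟ y)) (map f u)) ≡ does (All.all? (λ y → ¬? (g a ℕ.≟ y)) (map g u))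
  head-fresh [] _ = refl
  head-fresh (z ∷ u) (z∈ ∷ u⊆X) =
    cong₂ _∧_ (cong not (does-⇔ (same-eq a∈ z∈) (f a ℕ.≟ f z) (g a ℕ.≟ g z))) (head-fresh u u⊆X)

remove : ℕ → List ℕ → List ℕ
remove a = filter (λ x → ¬? (a ℕ.≟ x))

remove-head : ∀ {x S} → x ∉ S → remove x (x ∷ S) ≡ S
remove-head {x} {S} x∉S =
  trans (filter-reject (λ y → ¬? (x ℕ.≟ y)) (λ x≢x → x≢x refl))
        (filter-all (λ y → ¬? (x ℕ.≟ y)) (All.tabulate (λ y∈S x≡y → x∉S (subst (_∈ S) (sym x≡y) y∈S))))

remove-∷ : ∀ {a x} S → a ≢ x → remove a (x ∷ S) ≡ x ∷ remove a S
remove-∷ {a} S a≢x = filter-accept (λ y → ¬? (a ℕ.≟ y)) a≢x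

length-remove : ∀ {a} S → a ∈ S → Unique S → suc (length (remove a S)) ≡ length S
length-remove (x ∷ S) (here refl) u = cong (suc ∘ length) (remove-head (Unique.Unique[x∷xs]⇒x∉xs u))
length-remove {a} (x ∷ S) (there a∈S) u@(_ ∷ uS) with a ℕ.≟ x
... | yes refl = contradiction a∈S (Unique.Unique[x∷xs]⇒x∉xs u)
... | no a≢x = cong (suc ∘ length) (remove-∷ S a≢x) ⟨ trans ⟩ cong suc (length-remove S a∈S uS)

remove-⊆ : ∀ {x xs zs} → All (x ≢_) xs → (x ∷ xs) ⊆ zs → xs ⊆ remove x zs
remove-⊆ x∉xs x∷xs⊆zs y∈ = ∈-filter⁺ _ (x∷xs⊆zs (there y∈)) (All.lookup x∉xs y∈)

length-remove< : ∀ {x} zs → x ∈ zs → length (remove x zs) < length zs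
length-remove< zs x∈ = filter-notAll _ zs (Any.map (λ x≡y x≢y → x≢y x≡y) x∈)

length-≤-⊆ : ∀ xs zs → Unique xs → xs ⊆ zs → length xs ≤ length zs
length-≤-⊆ [] zs _ _ = z≤n
length-≤-⊆ (x ∷ xs) zs (x∉xs ∷ u) x∷xs⊆zs =
  ≤-trans (s≤s (length-≤-⊆ xs (remove x zs) u (remove-⊆ x∉xs x∷xs⊆zs))) (length-remove< zs (x∷xs⊆zs (here refl)))

unique-⊆-length⇒↭ : ∀ xs ys → Unique xs → Unique ys → xs ⊆ ys → length ys ≤ length xs → xs ↭ ys
unique-⊆-length⇒↭ xs ys uxs uys xs⊆ys |ys|≤|xs| = ∼bag⇒↭ (unique∧set⇒bag uxs uys (mk⇔ xs⊆ys ys⊆xs))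
  where
  ys⊆xs : ys ⊆ xs
  ys⊆xs {y} y∈ys with y ∈? xs
  ... | yes y∈xs = y∈xs
  ... | no y∉xs = contradiction |ys|≤|xs| (<⇒≱ (≤-<-trans shorter (length-remove< ys y∈ys)))
    where
    shorter : length xs ≤ length (remove y ys)
    shorter = length-≤-⊆ xs (remove y ys) uxs
                (λ x∈ → ∈-filter⁺ _ (xs⊆ys x∈) (λ y≡x → y∉xs (subst (_∈ xs) (sym y≡x) x∈)))

interval : ℕ → ℕ → List ℕ
interval lo zero = []
interval lo (suc n) = suc lo ∷ interval (suc lo) n

range≡interval : ∀ m → range m ≡ interval 0 m
range≡interval m = shifted id 0 m (λ _ → refl)
  where
  shifted : ∀ (f : ℕ → ℕ) lo n → (∀ i → f i ≡ lo + i) → map suc (applyUpTo f n) ≡ interval lo n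
  shifted f lo zero _ = refl
  shifted f lo (suc n) f≡ =
    cong₂ _∷_ (cong suc (trans (f≡ 0) (+-identityʳ lo))) (shifted (f ∘ suc) (suc lo) n (λ i → trans (f≡ (suc i)) (+-suc lo i)))

∈-interval⁻ : ∀ {lo n x} → x ∈ interval lo n → lo < x × x ≤ lo + n
∈-interval⁻ {lo} {suc n} (here refl) = ≤-refl , subst (suc lo ≤_) (sym (+-suc lo n)) (s≤s (m≤m+n lo n))
∈-interval⁻ {lo} {suc n} {x} (there x∈) with lo<x , x≤ ← ∈-interval⁻ x∈ = <-trans (n<1+n lo) lo<x , subst (x ≤_) (sym (+-suc lo n)) x≤

∈-interval⁺ : ∀ {lo n x} → lo < x → x ≤ lo + n → x ∈ interval lo n
∈-interval⁺ {lo} {zero} {x} lo<x x≤lo = contradiction (subst (x ≤_) (+-identityʳ lo) x≤lo) (<⇒≱ lo<x)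
∈-interval⁺ {lo} {suc n} {x} lo<x x≤ with x ℕ.≟ suc lo
... | yes refl = here refl
... | no x≢ = there (∈-interval⁺ (≤∧≢⇒< lo<x (x≢ ∘ sym)) (subst (x ≤_) (+-suc lo n) x≤))

interval-unique : ∀ lo n → Unique (interval lo n)
interval-unique lo zero = []
interval-unique lo (suc n) = All.tabulate (λ x∈ lo≡x → <-irrefl lo≡x (proj₁ (∈-interval⁻ x∈))) ∷ interval-unique (suc lo) n

length-interval : ∀ lo n → length (interval lo n) ≡ n
length-interval lo zero = refl
length-interval lo (suc n) = cong suc (length-interval (suc lo) n)

interval-++ : ∀ lo a b → interval lo (a + b) ≡ interval lo a ++ interval (lo + a) b
interval-++ lo zero b = cong (λ i → interval i b) (sym (+-identityʳ lo))
interval-++ lo (suc a) b = cong (suc lo ∷_) (trans (interval-++ (suc lo) a b) (cong (λ i → interval (suc lo) a ++ interval i b) (sym (+-suc lo a))))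

interval-split : ∀ a l → interval 0 (suc a + l) ≡ interval 0 a ++ suc a ∷ interval (suc a) l
interval-split a l = trans (cong (interval 0) (sym (+-suc a l))) (interval-++ 0 a (suc l))

countᵇ-words-suc : {A : Set} (n : ℕ) (X : List A) (q : List A → Bool) →
  countᵇ q (words (suc n) X) ≡ ∑ X (λ x → countᵇ (q ∘ (x ∷_)) (words n X))
countᵇ-words-suc n X q =
  trans (countᵇ-concatMap q _ X) (∑-cong X (λ {x} _ → countᵇ-map q (x ∷_) (words n X)))

countᵇ-words-map : {A B : Set} (n : ℕ) (g : A → B) (X : List A) (q : List B → Bool) →
  countᵇ q (words n (map g X)) ≡ countᵇ (q ∘ map g) (words n X)
countᵇ-words-map zero g X q = countᵇ-map q (map g) ([] ∷ [])
countᵇ-words-map (suc n) g X q = begin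
  countᵇ q (words (suc n) (map g X))                               ≡⟨ countᵇ-words-suc n (map g X) q ⟩
  ∑ (map g X) (λ y → countᵇ (q ∘ (y ∷_)) (words n (map g X)))      ≡⟨ ∑-map g X _ ⟩
  ∑ X (λ x → countᵇ (q ∘ (g x ∷_)) (words n (map g X)))            ≡⟨ ∑-cong X (λ {x} _ → countᵇ-words-map n g X (q ∘ (g x ∷_))) ⟩
  ∑ X (λ x → countᵇ (q ∘ map g ∘ (x ∷_)) (words n X))              ≡⟨ sym (countᵇ-words-suc n X (q ∘ map g)) ⟩
  countᵇ (q ∘ map g) (words (suc n) X)                             ∎
  where open ≡-Reasoning

countᵇ-words-cong : {A : Set} (n : ℕ) (X : List A) {q q′ : List A → Bool} →
  (∀ w → All (_∈ X) w → q w ≡ q′ w) → countᵇ q (words n X) ≡ countᵇ q′ (words n X)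
countᵇ-words-cong zero X {q} {q′} q≡q′ =
  trans (countᵇ≡∑ q ([] ∷ [])) (trans (cong (λ b → ind b + 0) (q≡q′ [] [])) (sym (countᵇ≡∑ q′ ([] ∷ []))))
countᵇ-words-cong (suc n) X {q} {q′} q≡q′ =
  trans (countᵇ-words-suc n X q)
  (trans (∑-cong X (λ x∈X → countᵇ-words-cong n X (λ w w⊆X → q≡q′ _ (x∈X ∷ w⊆X))))
  (sym (countᵇ-words-suc n X q′)))

countᵇ-words-↭ : {A : Set} (n : ℕ) {X Y : List A} (q : List A → Bool) → X ↭ Y →
  countᵇ q (words n X) ≡ countᵇ q (words n Y)
countᵇ-words-↭ zero q X↭Y = refl
countᵇ-words-↭ (suc n) {X} {Y} q X↭Y =
  trans (countᵇ-words-suc n X q)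
  (trans (∑-cong X (λ {x} _ → countᵇ-words-↭ n (q ∘ (x ∷_)) X↭Y))
  (trans (∑-↭ _ X↭Y) (sym (countᵇ-words-suc n Y q))))

countᵇ-words-all : {A : Set} {P : A → Set} (P? : Decidable P) (n : ℕ) (Y : List A) (r : List A → Bool) →
  countᵇ (λ w → does (All.all? P? w) ∧ r w) (words n Y) ≡ countᵇ r (words n (filter P? Y))
countᵇ-words-all P? zero Y r = trans (countᵇ≡∑ (λ w → does (All.all? P? w) ∧ r w) ([] ∷ [])) (sym (countᵇ≡∑ r ([] ∷ [])))
countᵇ-words-all {A} P? (suc n) Y r =
  trans (countᵇ-words-suc n Y (λ w → does (All.all? P? w) ∧ r w))
  (trans (first-letters Y) (sym (countᵇ-words-suc n (filter P? Y) r)))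
  where
  allowed-after : A → ℕ
  allowed-after x = countᵇ (λ w → does (All.all? P? (x ∷ w)) ∧ r (x ∷ w)) (words n Y)

  first-letters : ∀ Z → ∑ Z allowed-after ≡ ∑ (filter P? Z) (λ x → countᵇ (r ∘ (x ∷_)) (words n (filter P? Y)))
  first-letters [] = refl
  first-letters (z ∷ Z) with does (P? z)
  ... | false = trans (cong (_+ ∑ Z allowed-after) (countᵇ-const-false (words n Y))) (first-letters Z)
  ... | true = cong₂ _+_ (countᵇ-words-all P? n Y (r ∘ (z ∷_))) (first-letters Z)

∈-last : {A : Set} {x : A} (w : List A) → last w ≡ just x → x ∈ w
∈-last (a ∷ []) refl = here refl
∈-last (a ∷ b ∷ w) last≡ = there (∈-last (b ∷ w) last≡)

lastIsℤ-true⇒last : ∀ {v} w → lastIsℤ v w ≡ true → last w ≡ just v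
lastIsℤ-true⇒last {v} (x ∷ []) isLast with x ℤ.≟ v
... | yes x≡v = cong just x≡v
lastIsℤ-true⇒last (x ∷ y ∷ w) isLast = lastIsℤ-true⇒last (y ∷ w) isLast

lastIs-map : {X : List ℤ} (g : ℤ → ℕ) → (∀ {a b} → a ∈ X → b ∈ X → g a ≡ g b → a ≡ b) →
  ∀ {v} → v ∈ X → ∀ w → All (_∈ X) w → lastIsℤ v w ≡ lastIsℕ (g v) (map g w)
lastIs-map g g-inj v∈ [] _ = refl
lastIs-map g g-inj {v} v∈ (x ∷ []) (x∈ ∷ []) = does-⇔ (mk⇔ (cong g) (λ gx≡gv → g-inj x∈ v∈ gx≡gv)) (x ℤ.≟ v) (g x ℕ.≟ g v)
lastIs-map g g-inj v∈ (x ∷ y ∷ w) (_ ∷ w∈) = lastIs-map g g-inj v∈ (y ∷ w) w∈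

desℕ-map-cong : {A : Set} {P : A → Set} (f g : A → ℕ) →
  (∀ {a b} → P a → P b → does (f b <? f a) ≡ does (g b <? g a)) → ∀ w → All P w → desℕ (map f w) ≡ desℕ (map g w)
desℕ-map-cong f g same-order [] _ = refl
desℕ-map-cong f g same-order (a ∷ []) _ = refl
desℕ-map-cong f g same-order (a ∷ b ∷ w) (Pa ∷ Pbw@(Pb ∷ _)) =
  cong₂ (λ x y → ind x + y) (same-order Pa Pb) (desℕ-map-cong f g same-order (b ∷ w) Pbw)

-- Sign patterns and binomial sums

signed : List ℕ → List ℤ
signed S = map +_ S ++ map (λ k → - (+ k)) S

±pairs : List ℕ → List ℤ
±pairs [] = []
±pairs (x ∷ S) = + x ∷ - (+ x) ∷ ±pairs S

signed↭±pairs : ∀ S → signed S ↭ ±pairs S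
signed↭±pairs [] = ↭-refl
signed↭±pairs (x ∷ S) =
  prep (+ x) (↭-trans (↭.shift (- (+ x)) (map +_ S) (map (λ k → - (+ k)) S)) (prep (- (+ x)) (signed↭±pairs S)))

∣∣-∈-±pairs : ∀ S {y} → y ∈ ±pairs S → ∣ y ∣ ∈ S
∣∣-∈-±pairs (x ∷ S) (here refl) = here refl
∣∣-∈-±pairs (x ∷ S) (there (here refl)) = here (∣-i∣≡∣i∣ (+ x))
∣∣-∈-±pairs (x ∷ S) (there (there y∈)) = there (∣∣-∈-±pairs S y∈)

signings : List ℕ → List (List ℤ)
signings [] = [] ∷ []
signings (x ∷ S) = map (+ x ∷_) (signings S) ++ map (- (+ x) ∷_) (signings S)

∑-signings-∷ : ∀ x S (F : List ℤ → ℕ) →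
  ∑ (signings (x ∷ S)) F ≡ ∑ (signings S) (F ∘ (+ x ∷_)) + ∑ (signings S) (F ∘ (- (+ x) ∷_))
∑-signings-∷ x S F =
  trans (∑-++ (map (+ x ∷_) (signings S)) _ F) (cong₂ _+_ (∑-map _ (signings S) F) (∑-map _ (signings S) F))

∑-signings-++ : ∀ xs ys (F : List ℤ → ℕ) →
  ∑ (signings (xs ++ ys)) F ≡ ∑ (signings xs) (λ T₁ → ∑ (signings ys) (λ T₂ → F (T₁ ++ T₂)))
∑-signings-++ [] ys F = sym (+-identityʳ _)
∑-signings-++ (x ∷ xs) ys F =
  trans (∑-signings-∷ x (xs ++ ys) F)
  (trans (cong₂ _+_ (∑-signings-++ xs ys (F ∘ (+ x ∷_))) (∑-signings-++ xs ys (F ∘ (- (+ x) ∷_))))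
  (sym (∑-signings-∷ x xs _)))

∑-signings-const : ∀ S K → ∑ (signings S) (λ _ → K) ≡ 2 ^ length S * K
∑-signings-const [] K = refl
∑-signings-const (x ∷ S) K =
  trans (∑-signings-∷ x S (λ _ → K))
  (trans (cong₂ _+_ (∑-signings-const S K) (∑-signings-const S K))
  (sym (trans (*-assoc 2 (2 ^ length S) K) (cong (_+_ (2 ^ length S * K)) (+-identityʳ _)))))

map-∣∣-signing : ∀ S {T} → T ∈ signings S → map ∣_∣ T ≡ S
map-∣∣-signing [] (here refl) = refl
map-∣∣-signing (x ∷ S) T∈ with ∈-++⁻ (map (+ x ∷_) (signings S)) T∈
... | inj₁ T∈₊ with _ , T′∈ , refl ← ∈-map⁻ (+ x ∷_) T∈₊ = cong (x ∷_) (map-∣∣-signing S T′∈)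
... | inj₂ T∈₋ with _ , T′∈ , refl ← ∈-map⁻ (- (+ x) ∷_) T∈₋ = cong₂ _∷_ (∣-i∣≡∣i∣ (+ x)) (map-∣∣-signing S T′∈)

length-signing : ∀ S {T} → T ∈ signings S → length T ≡ length S
length-signing S {T} T∈ = trans (sym (length-map ∣_∣ T)) (cong length (map-∣∣-signing S T∈))

∣∣-∈-signing : ∀ S {T z} → T ∈ signings S → z ∈ T → ∣ z ∣ ∈ S
∣∣-∈-signing S T∈ z∈T = subst (_ ∈_) (map-∣∣-signing S T∈) (∈-map⁺ ∣_∣ z∈T)

isNeg : ℤ → Bool
isNeg (+ _) = false
isNeg -[1+ _ ] = true

negatives : List ℤ → ℕ
negatives = countᵇ isNeg

negatives≤length : ∀ T → negatives T ≤ length T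
negatives≤length T = subst (negatives T ≤_) (countᵇ-not+countᵇ isNeg T) (m≤n+m _ _)

sumTo-cong : ∀ n {f g : ℕ → ℕ} → (∀ j → f j ≡ g j) → sumTo n f ≡ sumTo n g
sumTo-cong zero f≡g = f≡g 0
sumTo-cong (suc n) f≡g = cong₂ _+_ (sumTo-cong n f≡g) (f≡g (suc n))

sumTo-+ : ∀ n (f g : ℕ → ℕ) → sumTo n (λ j → f j + g j) ≡ sumTo n f + sumTo n g
sumTo-+ zero f g = refl
sumTo-+ (suc n) f g = trans (cong (_+ (f (suc n) + g (suc n))) (sumTo-+ n f g)) (+-interchange (sumTo n f) _ _ _)

sumTo-suc : ∀ n (f : ℕ → ℕ) → sumTo (suc n) f ≡ f 0 + sumTo n (f ∘ suc)
sumTo-suc zero f = refl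
sumTo-suc (suc n) f = trans (cong (_+ f (suc (suc n))) (sumTo-suc n f)) (+-assoc (f 0) _ _)

sumTo-pascal : ∀ n (F : ℕ → ℕ) →
  sumTo (suc n) (λ j → (suc n C j) * F j) ≡ sumTo n (λ j → (n C j) * F j) + sumTo n (λ j → (n C j) * F (suc j))
sumTo-pascal n F = begin
  sumTo (suc n) (λ j → (suc n C j) * F j)
    ≡⟨ sumTo-suc n _ ⟩
  F 0 + 0 + sumTo n (λ j → (suc n C suc j) * F (suc j))
    ≡⟨ cong (_+_ (F 0 + 0)) (trans (sumTo-cong n split) (sumTo-+ n _ _)) ⟩
  F 0 + 0 + (sumTo n (λ j → (n C j) * F (suc j)) + sumTo n (λ j → (n C suc j) * F (suc j)))
    ≡⟨ x+[y+z]≡[x+z]+y (F 0 + 0) _ _ ⟩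
  F 0 + 0 + sumTo n (λ j → (n C suc j) * F (suc j)) + sumTo n (λ j → (n C j) * F (suc j))
    ≡⟨ cong (_+ sumTo n (λ j → (n C j) * F (suc j))) (sym unshift) ⟩
  sumTo n (λ j → (n C j) * F j) + sumTo n (λ j → (n C j) * F (suc j))
    ∎
  where
  open ≡-Reasoning
  split : ∀ j → (suc n C suc j) * F (suc j) ≡ (n C j) * F (suc j) + (n C suc j) * F (suc j)
  split j = trans (cong (_* F (suc j)) (sym (nCk+nC[k+1]≡[n+1]C[k+1] n j))) (*-distribʳ-+ (F (suc j)) (n C j) (n C suc j))
  unshift : sumTo n (λ j → (n C j) * F j) ≡ F 0 + 0 + sumTo n (λ j → (n C suc j) * F (suc j))
  unshift = begin
    sumTo n (λ j → (n C j) * F j)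
      ≡⟨ sym (+-identityʳ _) ⟩
    sumTo n (λ j → (n C j) * F j) + 0
      ≡⟨ cong (λ c → sumTo n (λ j → (n C j) * F j) + c * F (suc n)) (sym (k>n⇒nCk≡0 (n<1+n n))) ⟩
    sumTo (suc n) (λ j → (n C j) * F j)
      ≡⟨ sumTo-suc n _ ⟩
    F 0 + 0 + sumTo n (λ j → (n C suc j) * F (suc j))
      ∎

-- 0 is excluded because - (+ 0) is + 0, which is not negative.
∑-signings-negatives : ∀ S → All (0 <_) S → (F : ℕ → ℕ) →
  ∑ (signings S) (F ∘ negatives) ≡ sumTo (length S) (λ j → (length S C j) * F j)
∑-signings-negatives [] [] F = refl
∑-signings-negatives (suc x ∷ S) (_ ∷ S⁺) F = begin
  ∑ (signings (suc x ∷ S)) (F ∘ negatives)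
    ≡⟨ ∑-signings-∷ (suc x) S (F ∘ negatives) ⟩
  ∑ (signings S) (F ∘ negatives) + ∑ (signings S) (F ∘ suc ∘ negatives)
    ≡⟨ cong₂ _+_ (∑-signings-negatives S S⁺ F) (∑-signings-negatives S S⁺ (F ∘ suc)) ⟩
  sumTo (length S) (λ j → (length S C j) * F j) + sumTo (length S) (λ j → (length S C j) * F (suc j))
    ≡⟨ sym (sumTo-pascal (length S) F) ⟩
  sumTo (suc (length S)) (λ j → (suc (length S) C j) * F j)
    ∎
  where open ≡-Reasoning

AbsDistinct : List ℤ → Set
AbsDistinct w = Unique (map ∣_∣ w)

absDistinct? : Decidable AbsDistinct
absDistinct? w = UniqueDec.unique? ℕ._≟_ (map ∣_∣ w)

absDistinctWords : ℕ → List ℤ → List (List ℤ)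
absDistinctWords n Y = filter absDistinct? (words n Y)

dropAbs : ℤ → List ℤ → List ℤ
dropAbs y = filter (λ z → ¬? (∣ y ∣ ℕ.≟ ∣ z ∣))

dropAbs-∷ : ∀ y z T → ∣ y ∣ ≢ ∣ z ∣ → dropAbs y (z ∷ T) ≡ z ∷ dropAbs y T
dropAbs-∷ y z T y≢z = filter-accept (λ z → ¬? (∣ y ∣ ℕ.≟ ∣ z ∣)) y≢z

dropAbs-∷-same : ∀ y z T → ∣ y ∣ ≡ ∣ z ∣ → dropAbs y (z ∷ T) ≡ dropAbs y T
dropAbs-∷-same y z T y≡z = filter-reject (λ z → ¬? (∣ y ∣ ℕ.≟ ∣ z ∣)) (λ y≢z → y≢z y≡z)

dropAbs-±pairs : ∀ y S → dropAbs y (±pairs S) ≡ ±pairs (remove ∣ y ∣ S)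
dropAbs-±pairs y [] = refl
dropAbs-±pairs y (x ∷ S) with ∣ y ∣ ℕ.≟ x
... | yes y≡x = begin
  dropAbs y (+ x ∷ - (+ x) ∷ ±pairs S)  ≡⟨ dropAbs-∷-same y (+ x) _ y≡x ⟩
  dropAbs y (- (+ x) ∷ ±pairs S)        ≡⟨ dropAbs-∷-same y (- (+ x)) _ (trans y≡x (sym (∣-i∣≡∣i∣ (+ x)))) ⟩
  dropAbs y (±pairs S)                  ≡⟨ dropAbs-±pairs y S ⟩
  ±pairs (remove ∣ y ∣ S)               ≡⟨ cong ±pairs (sym (filter-reject (λ z → ¬? (∣ y ∣ ℕ.≟ z)) (λ y≢x → y≢x y≡x))) ⟩
  ±pairs (remove ∣ y ∣ (x ∷ S))         ∎
  where open ≡-Reasoning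
... | no y≢x = begin
  dropAbs y (+ x ∷ - (+ x) ∷ ±pairs S)  ≡⟨ dropAbs-∷ y (+ x) _ y≢x ⟩
  + x ∷ dropAbs y (- (+ x) ∷ ±pairs S)  ≡⟨ cong (+ x ∷_) (dropAbs-∷ y (- (+ x)) _ (λ y≡x → y≢x (trans y≡x (∣-i∣≡∣i∣ (+ x))))) ⟩
  + x ∷ - (+ x) ∷ dropAbs y (±pairs S)  ≡⟨ cong (λ L → + x ∷ - (+ x) ∷ L) (dropAbs-±pairs y S) ⟩
  ±pairs (x ∷ remove ∣ y ∣ S)           ≡⟨ cong ±pairs (sym (remove-∷ S y≢x)) ⟩
  ±pairs (remove ∣ y ∣ (x ∷ S))         ∎
  where open ≡-Reasoning

does-all?-map : {A B : Set} {P : B → Set} (P? : Decidable P) (f : A → B) (w : List A) →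
  does (All.all? P? (map f w)) ≡ does (All.all? (P? ∘ f) w)
does-all?-map P? f [] = refl
does-all?-map P? f (x ∷ w) = cong (does (P? (f x)) ∧_) (does-all?-map P? f w)

countᵇ-absDistinctWords-suc : (n : ℕ) (Y : List ℤ) (q : List ℤ → Bool) →
  countᵇ q (absDistinctWords (suc n) Y) ≡ ∑ Y (λ y → countᵇ (q ∘ (y ∷_)) (absDistinctWords n (dropAbs y Y)))
countᵇ-absDistinctWords-suc n Y q =
  trans (countᵇ-filter absDistinct? q (words (suc n) Y))
  (trans (countᵇ-words-suc n Y _)
  (∑-cong Y λ {y} _ →
    trans (countᵇ-words-cong n Y (λ w _ → head-condition y w))
    (trans (countᵇ-words-all (λ z → ¬? (∣ y ∣ ℕ.≟ ∣ z ∣)) n Y (λ w → does (absDistinct? w) ∧ q (y ∷ w)))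
    (sym (countᵇ-filter absDistinct? (q ∘ (y ∷_)) (words n (dropAbs y Y)))))))
  where
  head-condition : ∀ y w → does (absDistinct? (y ∷ w)) ∧ q (y ∷ w)
                         ≡ does (All.all? (λ z → ¬? (∣ y ∣ ℕ.≟ ∣ z ∣)) w) ∧ (does (absDistinct? w) ∧ q (y ∷ w))
  head-condition y w =
    trans (cong (λ b → (b ∧ does (absDistinct? w)) ∧ q (y ∷ w)) (does-all?-map (λ b → ¬? (∣ y ∣ ℕ.≟ b)) ∣_∣ w))
          (∧-assoc (does (All.all? (λ z → ¬? (∣ y ∣ ℕ.≟ ∣ z ∣)) w)) (does (absDistinct? w)) (q (y ∷ w)))

∣∣≢-signing : ∀ S {T} s {z} → T ∈ signings S → ∣ s ∣ ∉ S → z ∈ T → ∣ s ∣ ≢ ∣ z ∣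
∣∣≢-signing S s T∈ s∉S z∈T s≡z = s∉S (subst (_∈ S) (sym s≡z) (∣∣-∈-signing S T∈ z∈T))

dropAbs-signing-head : ∀ S {T} s → T ∈ signings S → ∣ s ∣ ∉ S → dropAbs s (s ∷ T) ≡ T
dropAbs-signing-head S {T} s T∈ s∉S =
  trans (dropAbs-∷-same s s T refl) (filter-all (λ z → ¬? (∣ s ∣ ℕ.≟ ∣ z ∣)) (All.tabulate (∣∣≢-signing S s T∈ s∉S)))

dropAbs-signing-tail : ∀ S {T} s {y} → T ∈ signings S → ∣ s ∣ ∉ S → y ∈ T → dropAbs y (s ∷ T) ≡ s ∷ dropAbs y T
dropAbs-signing-tail S {T} s {y} T∈ s∉S y∈T = dropAbs-∷ y s T (∣∣≢-signing S s T∈ s∉S y∈T ∘ sym)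

-- Choosing a signing and then one of its letters is the same as choosing a signed
-- letter and then a signing of the remaining absolute values.
∑-signings-exchange : ∀ S → Unique S → (F : ℤ → List ℤ → ℕ) →
  ∑ (signings S) (λ T → ∑ T (λ y → F y (dropAbs y T)))
    ≡ ∑ (±pairs S) (λ y → ∑ (signings (remove ∣ y ∣ S)) (F y))
∑-signings-exchange [] _ F = refl
∑-signings-exchange (x ∷ S) u@(_ ∷ uS) F = begin
  ∑ (signings (x ∷ S)) G
    ≡⟨ ∑-signings-∷ x S G ⟩
  ∑ (signings S) (G ∘ (+ x ∷_)) + ∑ (signings S) (G ∘ (- (+ x) ∷_))
    ≡⟨ cong₂ _+_ (prepend (+ x) x∉S) (prepend (- (+ x)) (subst (_∉ S) (sym (∣-i∣≡∣i∣ (+ x))) x∉S)) ⟩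
  (∑ (signings S) (F (+ x)) + Rest (+ x)) + (∑ (signings S) (F (- (+ x))) + Rest (- (+ x)))
    ≡⟨ +-assoc (∑ (signings S) (F (+ x))) _ _ ⟩
  ∑ (signings S) (F (+ x)) + (Rest (+ x) + (∑ (signings S) (F (- (+ x))) + Rest (- (+ x))))
    ≡⟨ cong (_+_ (∑ (signings S) (F (+ x)))) (x+[y+z]≡y+[x+z] (Rest (+ x)) (∑ (signings S) (F (- (+ x)))) (Rest (- (+ x)))) ⟩
  ∑ (signings S) (F (+ x)) + (∑ (signings S) (F (- (+ x))) + (Rest (+ x) + Rest (- (+ x))))
    ≡⟨ sym (cong₂ _+_ (removed (+ x) refl) (cong₂ _+_ (removed (- (+ x)) (∣-i∣≡∣i∣ (+ x))) rest-split)) ⟩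
  ∑ (±pairs (x ∷ S)) (λ y → ∑ (signings (remove ∣ y ∣ (x ∷ S))) (F y))
    ∎
  where
  open ≡-Reasoning
  x∉S : x ∉ S
  x∉S = Unique.Unique[x∷xs]⇒x∉xs u

  G : List ℤ → ℕ
  G T = ∑ T (λ y → F y (dropAbs y T))

  Rest : ℤ → ℕ
  Rest s = ∑ (±pairs S) (λ y → ∑ (signings (remove ∣ y ∣ S)) (λ T → F y (s ∷ T)))

  prepend : ∀ s → ∣ s ∣ ∉ S → ∑ (signings S) (G ∘ (s ∷_)) ≡ ∑ (signings S) (F s) + Rest s
  prepend s s∉S = begin
    ∑ (signings S) (λ T → F s (dropAbs s (s ∷ T)) + ∑ T (λ y → F y (dropAbs y (s ∷ T))))
      ≡⟨ ∑-cong (signings S) (λ T∈ → cong₂ _+_ (cong (F s) (dropAbs-signing-head S s T∈ s∉S))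
                                                (∑-cong _ (λ {y} y∈T → cong (F y) (dropAbs-signing-tail S s T∈ s∉S y∈T)))) ⟩
    ∑ (signings S) (λ T → F s T + ∑ T (λ y → F y (s ∷ dropAbs y T)))
      ≡⟨ ∑-+ (signings S) (F s) _ ⟩
    ∑ (signings S) (F s) + ∑ (signings S) (λ T → ∑ T (λ y → F y (s ∷ dropAbs y T)))
      ≡⟨ cong (_+_ (∑ (signings S) (F s))) (∑-signings-exchange S uS (λ y T → F y (s ∷ T))) ⟩
    ∑ (signings S) (F s) + Rest s
      ∎

  removed : ∀ s → ∣ s ∣ ≡ x → ∑ (signings (remove ∣ s ∣ (x ∷ S))) (F s) ≡ ∑ (signings S) (F s)
  removed s ∣s∣≡x = cong (λ L → ∑ (signings L) (F s)) (trans (cong (λ a → remove a (x ∷ S)) ∣s∣≡x) (remove-head x∉S))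

  rest-split : ∑ (±pairs S) (λ y → ∑ (signings (remove ∣ y ∣ (x ∷ S))) (F y)) ≡ Rest (+ x) + Rest (- (+ x))
  rest-split =
    trans (∑-cong (±pairs S) (λ {y} y∈ →
            trans (cong (λ L → ∑ (signings L) (F y)) (remove-∷ S (λ y≡x → x∉S (subst (_∈ S) y≡x (∣∣-∈-±pairs S y∈)))))
                  (∑-signings-∷ x (remove ∣ y ∣ S) (F y))))
          (∑-+ (±pairs S) _ _)

countᵇ-absDistinctWords-±pairs : ∀ n S → length S ≡ n → Unique S → (q : List ℤ → Bool) →
  countᵇ q (absDistinctWords n (±pairs S)) ≡ ∑ (signings S) (λ T → countᵇ q (absDistinctWords n T))
countᵇ-absDistinctWords-±pairs zero [] refl _ q = sym (+-identityʳ _)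
countᵇ-absDistinctWords-±pairs (suc n) S |S|≡1+n u q = begin
  countᵇ q (absDistinctWords (suc n) (±pairs S))
    ≡⟨ countᵇ-absDistinctWords-suc n (±pairs S) q ⟩
  ∑ (±pairs S) (λ y → countᵇ (q ∘ (y ∷_)) (absDistinctWords n (dropAbs y (±pairs S))))
    ≡⟨ ∑-cong (±pairs S) (λ {y} y∈ → trans (cong (λ L → countᵇ (q ∘ (y ∷_)) (absDistinctWords n L)) (dropAbs-±pairs y S))
                                            (countᵇ-absDistinctWords-±pairs n (remove ∣ y ∣ S) (shorter y∈) (Unique.filter⁺ _ u) _)) ⟩
  ∑ (±pairs S) (λ y → ∑ (signings (remove ∣ y ∣ S)) (λ T → countᵇ (q ∘ (y ∷_)) (absDistinctWords n T)))
    ≡⟨ sym (∑-signings-exchange S u (λ y T → countᵇ (q ∘ (y ∷_)) (absDistinctWords n T))) ⟩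
  ∑ (signings S) (λ T → ∑ T (λ y → countᵇ (q ∘ (y ∷_)) (absDistinctWords n (dropAbs y T))))
    ≡⟨ ∑-cong (signings S) (λ {T} _ → sym (countᵇ-absDistinctWords-suc n T q)) ⟩
  ∑ (signings S) (λ T → countᵇ q (absDistinctWords (suc n) T))
    ∎
  where
  open ≡-Reasoning
  shorter : ∀ {y} → y ∈ ±pairs S → length (remove ∣ y ∣ S) ≡ n
  shorter y∈ = suc-injective (trans (length-remove S (∣∣-∈-±pairs S y∈) u) |S|≡1+n)

countᵇ-SignedPerms : ∀ m (q : List ℤ → Bool) →
  countᵇ q (SignedPerms m) ≡ ∑ (signings (range m)) (λ T → countᵇ q (absDistinctWords m T))
countᵇ-SignedPerms m q = begin
  countᵇ q (filter absDistinct? (words m (signed (range m))))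
    ≡⟨ countᵇ-filter absDistinct? q (words m (signed (range m))) ⟩
  countᵇ q′ (words m (signed (range m)))
    ≡⟨ countᵇ-words-↭ m q′ (signed↭±pairs (range m)) ⟩
  countᵇ q′ (words m (±pairs (range m)))
    ≡⟨ sym (countᵇ-filter absDistinct? q (words m (±pairs (range m)))) ⟩
  countᵇ q (absDistinctWords m (±pairs (range m)))
    ≡⟨ countᵇ-absDistinctWords-±pairs m (range m) length-range range-unique q ⟩
  ∑ (signings (range m)) (λ T → countᵇ q (absDistinctWords m T))
    ∎
  where
  open ≡-Reasoning
  q′ : List ℤ → Bool
  q′ w = does (absDistinct? w) ∧ q w

  length-range : length (range m) ≡ m
  length-range = trans (cong length (range≡interval m)) (length-interval 0 m)

  range-unique : Unique (range m)
  range-unique = subst Unique (sym (range≡interval m)) (interval-unique 0 m)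

-- A relabelling into ℕ that keeps the order within each sign but puts every
-- negative letter above every nonnegative one: −i ↦ 2m + 1 − i for 1 ≤ i ≤ m.
lift : ℕ → ℤ → ℕ
lift m (+ p) = p
lift m -[1+ n ] = m + (m ∸ n)

lift-nonneg<lift-neg : ∀ {m p q} → p ≤ m → q < m → p < m + (m ∸ q)
lift-nonneg<lift-neg {m} p≤m q<m = ≤-<-trans p≤m (m<m+n m (m<n⇒0<n∸m q<m))

lift-injective : ∀ m a b → ∣ a ∣ ≤ m → ∣ b ∣ ≤ m → lift m a ≡ lift m b → a ≡ b
lift-injective m (+ p) (+ q) _ _ p≡q = cong +_ p≡q
lift-injective m (+ p) -[1+ q ] ∣a∣≤m ∣b∣≤m eq = contradiction eq (<⇒≢ (lift-nonneg<lift-neg ∣a∣≤m ∣b∣≤m))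
lift-injective m -[1+ p ] (+ q) ∣a∣≤m ∣b∣≤m eq = contradiction (sym eq) (<⇒≢ (lift-nonneg<lift-neg ∣b∣≤m ∣a∣≤m))
lift-injective m -[1+ p ] -[1+ q ] ∣a∣≤m ∣b∣≤m eq =
  cong -[1+_] (∸-cancelˡ-≡ (<⇒≤ ∣a∣≤m) (<⇒≤ ∣b∣≤m) (+-cancelˡ-≡ m _ _ eq))

m≤lift-neg : ∀ m n → m ≤ lift m -[1+ n ]
m≤lift-neg m n = m≤m+n m (m ∸ n)

-- Compared with ℤ, the relabelling changes a comparison exactly when the signs differ,
-- which the sign indicators on both sides compensate.
descent-lift : ∀ m a b → ∣ a ∣ ≤ m → ∣ b ∣ ≤ m →
  ind (does (b ℤ.<? a)) + ind (isNeg a) ≡ ind (does (lift m b <? lift m a)) + ind (isNeg b)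
descent-lift m (+ p) (+ q) _ _ =
  cong (λ x → ind x + 0) (does-⇔ (mk⇔ drop‿+<+ ℤ.+<+) (+ q ℤ.<? + p) (q <? p))
descent-lift m (+ p) -[1+ q ] ∣a∣≤m ∣b∣≤m =
  cong (λ x → ind x + 1) (sym (dec-false (m + (m ∸ q) <? p) (<-asym (lift-nonneg<lift-neg ∣a∣≤m ∣b∣≤m))))
descent-lift m -[1+ p ] (+ q) ∣a∣≤m ∣b∣≤m =
  cong (λ x → ind x + 0) (sym (dec-true (q <? m + (m ∸ p)) (lift-nonneg<lift-neg ∣b∣≤m ∣a∣≤m)))
descent-lift m -[1+ p ] -[1+ q ] ∣a∣≤m ∣b∣≤m =
  cong (λ x → ind x + 1) (does-⇔ (mk⇔ to from) (-[1+ q ] ℤ.<? -[1+ p ]) (m + (m ∸ q) <? m + (m ∸ p)))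
  where
  to : -[1+ q ] ℤ.< -[1+ p ] → m + (m ∸ q) < m + (m ∸ p)
  to q>p = +-monoʳ-< m (∸-monoʳ-< (drop‿-<- q>p) (<⇒≤ ∣b∣≤m))
  from : m + (m ∸ q) < m + (m ∸ p) → -[1+ q ] ℤ.< -[1+ p ]
  from lt = ℤ.-<- (≰⇒> (λ q≤p → <⇒≱ lt (+-monoʳ-≤ m (∸-monoʳ-≤ m q≤p))))

desℤ-lift : ∀ m a w {p} → All (λ z → ∣ z ∣ ≤ m) (a ∷ w) → last (a ∷ w) ≡ just (+ p) →
  desℤ (a ∷ w) + ind (isNeg a) ≡ desℕ (map (lift m) (a ∷ w))
desℤ-lift m a [] _ refl = refl
desℤ-lift m a (b ∷ w) (∣a∣≤m ∷ bounded@(∣b∣≤m ∷ _)) last≡ = begin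
  ind (does (b ℤ.<? a)) + desℤ (b ∷ w) + ind (isNeg a)
    ≡⟨ [x+y]+z≡[x+z]+y (ind (does (b ℤ.<? a))) _ _ ⟩
  ind (does (b ℤ.<? a)) + ind (isNeg a) + desℤ (b ∷ w)
    ≡⟨ cong (_+ desℤ (b ∷ w)) (descent-lift m a b ∣a∣≤m ∣b∣≤m) ⟩
  ind (does (lift m b <? lift m a)) + ind (isNeg b) + desℤ (b ∷ w)
    ≡⟨ [x+y]+z≡[x+z]+y (ind (does (lift m b <? lift m a))) _ _ ⟩
  ind (does (lift m b <? lift m a)) + desℤ (b ∷ w) + ind (isNeg b)
    ≡⟨ +-assoc (ind (does (lift m b <? lift m a))) _ _ ⟩
  ind (does (lift m b <? lift m a)) + (desℤ (b ∷ w) + ind (isNeg b))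
    ≡⟨ cong (_+_ (ind (does (lift m b <? lift m a)))) (desℤ-lift m b w bounded last≡) ⟩
  ind (does (lift m b <? lift m a)) + desℕ (map (lift m) (b ∷ w))
    ∎
  where open ≡-Reasoning

desB≡desℕ∘lift : ∀ m w {p} → All (λ z → ∣ z ∣ ≤ m) w → last w ≡ just (+ p) → desB w ≡ desℕ (map (lift m) w)
desB≡desℕ∘lift m (x ∷ w) bounded last≡ =
  trans (sym (+-identityʳ (desB (x ∷ w)))) (desℤ-lift m (+ 0) (x ∷ w) (z≤n ∷ bounded) last≡)

-- Standardisation

rank : ℕ → List ℤ → ℤ → ℕ
rank m T x = suc (countᵇ (λ t → does (lift m t <? lift m x)) T)

lastDesB : ℕ → ℕ → List ℤ → Bool
lastDesB v k w = lastIsℤ (+ v) w ∧ does (desB w ℕ.≟ k)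

lastDesS : ℕ → ℕ → List ℕ → Bool
lastDesS r k σ = lastIsℕ r σ ∧ does (desS σ ℕ.≟ k)

countᵇ-lastDesB-∉ : ∀ m k v T → + v ∉ T → countᵇ (lastDesB v k) (absDistinctWords m T) ≡ 0
countᵇ-lastDesB-∉ m k v T +v∉T = begin
  countᵇ (lastDesB v k) (filter absDistinct? (words m T))           ≡⟨ countᵇ-filter absDistinct? (lastDesB v k) (words m T) ⟩
  countᵇ (λ w → does (absDistinct? w) ∧ lastDesB v k w) (words m T) ≡⟨ countᵇ-words-cong m T never ⟩
  countᵇ (λ _ → false) (words m T)                                  ≡⟨ countᵇ-const-false (words m T) ⟩
  0                                                                 ∎
  where
  open ≡-Reasoning
  never : ∀ w → All (_∈ T) w → does (absDistinct? w) ∧ lastDesB v k w ≡ false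
  never w w⊆T with lastIsℤ (+ v) w in isLast
  ... | false = ∧-zeroʳ (does (absDistinct? w))
  ... | true = contradiction (All.lookup w⊆T (∈-last w (lastIsℤ-true⇒last w isLast))) +v∉T

module Standardisation (m : ℕ) (T : List ℤ) (∣T∣≡interval : map ∣_∣ T ≡ interval 0 m) where

  ∣T∣-unique : Unique (map ∣_∣ T)
  ∣T∣-unique = subst Unique (sym ∣T∣≡interval) (interval-unique 0 m)

  bounded : ∀ {z} → z ∈ T → ∣ z ∣ ≤ m
  bounded z∈ = proj₂ (∈-interval⁻ (subst (_ ∈_) ∣T∣≡interval (∈-map⁺ ∣_∣ z∈)))

  length-T : length T ≡ m
  length-T = trans (sym (length-map ∣_∣ T)) (trans (cong length ∣T∣≡interval) (length-interval 0 m))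

  lift-injectiveOn : ∀ {a b} → a ∈ T → b ∈ T → lift m a ≡ lift m b → a ≡ b
  lift-injectiveOn a∈ b∈ = lift-injective m _ _ (bounded a∈) (bounded b∈)

  rank-mono : ∀ {a b} → b ∈ T → lift m b < lift m a → rank m T b < rank m T a
  rank-mono {a} {b} b∈ b<a =
    s≤s (countᵇ-does-< (λ t → lift m t <? lift m b) (λ t → lift m t <? lift m a) T (λ _ t<b → <-trans t<b b<a)
                       b∈ (<-irrefl refl) b<a)

  rank-<-does : ∀ {a b} → a ∈ T → b ∈ T → does (rank m T b <? rank m T a) ≡ does (lift m b <? lift m a)
  rank-<-does {a} {b} a∈ b∈ = does-⇔ (mk⇔ reflect (rank-mono {a} b∈)) (rank m T b <? rank m T a) (lift m b <? lift m a)
    where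
    reflect : rank m T b < rank m T a → lift m b < lift m a
    reflect rb<ra with <-cmp (lift m b) (lift m a)
    ... | tri< b<a _ _ = b<a
    ... | tri≈ _ b≡a _ = contradiction (subst (λ x → rank m T b < rank m T x) (sym (lift-injectiveOn b∈ a∈ b≡a)) rb<ra) (<-irrefl refl)
    ... | tri> _ _ a<b = contradiction (rank-mono {b} a∈ a<b) (<-asym rb<ra)

  rank-injectiveOn : ∀ {a b} → a ∈ T → b ∈ T → rank m T a ≡ rank m T b → a ≡ b
  rank-injectiveOn {a} {b} a∈ b∈ ra≡rb with <-cmp (lift m b) (lift m a)
  ... | tri< b<a _ _ = contradiction (sym ra≡rb) (<⇒≢ (rank-mono {a} b∈ b<a))
  ... | tri≈ _ b≡a _ = sym (lift-injectiveOn b∈ a∈ b≡a)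
  ... | tri> _ _ a<b = contradiction ra≡rb (<⇒≢ (rank-mono {b} a∈ a<b))

  rank≤m : ∀ {a} → a ∈ T → rank m T a ≤ m
  rank≤m {a} a∈ =
    subst (rank m T a ≤_) (trans (countᵇ-true T) length-T)
      (countᵇ-does-< (λ t → lift m t <? lift m a) (λ _ → yes tt) T (λ _ _ → tt) a∈ (<-irrefl refl) tt)

  ranks↭interval : map (rank m T) T ↭ interval 0 m
  ranks↭interval =
    unique-⊆-length⇒↭ _ _ (Unique-map⁺ T rank-injectiveOn (Unique.map⁻ ∣T∣-unique)) (interval-unique 0 m)
      (λ r∈ → let t , t∈ , r≡ = ∈-map⁻ (rank m T) r∈ in subst (_∈ interval 0 m) (sym r≡) (∈-interval⁺ (s≤s z≤n) (rank≤m t∈)))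
      (≤-reflexive (trans (length-interval 0 m) (sym (trans (length-map (rank m T) T) length-T))))

  ∣∣≡⇔rank≡ : ∀ {a b} → a ∈ T → b ∈ T → (∣ a ∣ ≡ ∣ b ∣) ⇔ (rank m T a ≡ rank m T b)
  ∣∣≡⇔rank≡ a∈ b∈ = mk⇔ (λ ∣a∣≡∣b∣ → cong (rank m T) (Unique-map⇒injectiveOn ∣_∣ T ∣T∣-unique a∈ b∈ ∣a∣≡∣b∣))
                        (λ ra≡rb → cong ∣_∣ (rank-injectiveOn a∈ b∈ ra≡rb))

  desB-rank : ∀ {p} w → All (_∈ T) w → lastIsℤ (+ p) w ≡ true → desB w ≡ desS (map (rank m T) w)
  desB-rank w w⊆T isLast =
    trans (desB≡desℕ∘lift m w (All.map bounded w⊆T) (lastIsℤ-true⇒last w isLast))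
          (desℕ-map-cong (lift m) (rank m T) (λ a∈ b∈ → sym (rank-<-does a∈ b∈)) w w⊆T)

  lastIs-rank : ∀ {v} → v ∈ T → ∀ w → All (_∈ T) w → lastIsℤ v w ≡ lastIsℕ (rank m T v) (map (rank m T) w)
  lastIs-rank = lastIs-map (rank m T) rank-injectiveOn

  lastDesB-rank : ∀ k {v} → + v ∈ T → ∀ w → All (_∈ T) w →
    lastDesB v k w ≡ lastDesS (rank m T (+ v)) k (map (rank m T) w)
  lastDesB-rank k {v} +v∈T w w⊆T with lastIsℤ (+ v) w in isLast
  ... | false = cong (_∧ does (desS (map (rank m T) w) ℕ.≟ k)) (trans (sym isLast) (lastIs-rank +v∈T w w⊆T))
  ... | true = cong₂ _∧_ (trans (sym isLast) (lastIs-rank +v∈T w w⊆T)) (cong (λ d → does (d ℕ.≟ k)) (desB-rank w w⊆T isLast))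

  countᵇ-lastDesB≡countᵇ-lastDesS : ∀ k {v} → + v ∈ T →
    countᵇ (lastDesB v k) (absDistinctWords m T) ≡ countᵇ (lastDesS (rank m T (+ v)) k) (Sym m)
  countᵇ-lastDesB≡countᵇ-lastDesS k {v} +v∈T = begin
    countᵇ (lastDesB v k) (filter absDistinct? (words m T))
      ≡⟨ countᵇ-filter absDistinct? (lastDesB v k) (words m T) ⟩
    countᵇ (λ w → does (absDistinct? w) ∧ lastDesB v k w) (words m T)
      ≡⟨ countᵇ-words-cong m T standardise ⟩
    countᵇ (Q ∘ map (rank m T)) (words m T)
      ≡⟨ sym (countᵇ-words-map m (rank m T) T Q) ⟩
    countᵇ Q (words m (map (rank m T) T))
      ≡⟨ countᵇ-words-↭ m Q ranks↭interval ⟩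
    countᵇ Q (words m (interval 0 m))
      ≡⟨ cong (λ L → countᵇ Q (words m L)) (sym (range≡interval m)) ⟩
    countᵇ Q (words m (range m))
      ≡⟨ sym (countᵇ-filter (UniqueDec.unique? ℕ._≟_) (lastDesS (rank m T (+ v)) k) (words m (range m))) ⟩
    countᵇ (lastDesS (rank m T (+ v)) k) (Sym m)
      ∎
    where
    open ≡-Reasoning
    Q : List ℕ → Bool
    Q σ = does (UniqueDec.unique? ℕ._≟_ σ) ∧ lastDesS (rank m T (+ v)) k σ

    standardise : ∀ w → All (_∈ T) w → does (absDistinct? w) ∧ lastDesB v k w ≡ Q (map (rank m T) w)
    standardise w w⊆T = cong₂ _∧_ (does-unique?-map-cong ∣_∣ (rank m T) ∣∣≡⇔rank≡ w w⊆T) (lastDesB-rank k +v∈T w w⊆T)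

rank-through : ∀ a l {T₁ T₂} → T₁ ∈ signings (interval 0 a) → T₂ ∈ signings (interval (suc a) l) →
  rank (suc a + l) (T₁ ++ + suc a ∷ T₂) (+ suc a) ≡ suc (a ∸ negatives T₁)
rank-through a l {T₁} {T₂} T₁∈ T₂∈ = cong suc (begin
  countᵇ below (T₁ ++ + suc a ∷ T₂)
    ≡⟨ countᵇ-++ below T₁ (+ suc a ∷ T₂) ⟩
  countᵇ below T₁ + countᵇ below (+ suc a ∷ T₂)
    ≡⟨ cong₂ _+_ (countᵇ-cong T₁ below-T₁) (trans (countᵇ-cong (+ suc a ∷ T₂) below-rest) (countᵇ-const-false (+ suc a ∷ T₂))) ⟩
  countᵇ (not ∘ isNeg) T₁ + 0
    ≡⟨ +-identityʳ _ ⟩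
  countᵇ (not ∘ isNeg) T₁
    ≡⟨ sym (m+n∸n≡m _ (negatives T₁)) ⟩
  countᵇ (not ∘ isNeg) T₁ + negatives T₁ ∸ negatives T₁
    ≡⟨ cong (_∸ negatives T₁) (trans (countᵇ-not+countᵇ isNeg T₁) length-T₁) ⟩
  a ∸ negatives T₁
    ∎)
  where
  open ≡-Reasoning
  m = suc a + l

  below : ℤ → Bool
  below t = does (lift m t <? suc a)

  length-T₁ : length T₁ ≡ a
  length-T₁ = trans (length-signing (interval 0 a) T₁∈) (length-interval 0 a)

  below-T₁ : ∀ {t} → t ∈ T₁ → below t ≡ not (isNeg t)
  below-T₁ {+ p} t∈ = dec-true (p <? suc a) (s≤s (proj₂ (∈-interval⁻ (∣∣-∈-signing (interval 0 a) T₁∈ t∈))))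
  below-T₁ { -[1+ n ]} t∈ = dec-false (lift m -[1+ n ] <? suc a) (≤⇒≯ (≤-trans (m≤m+n (suc a) l) (m≤lift-neg m n)))

  below-rest : ∀ {t} → t ∈ + suc a ∷ T₂ → below t ≡ false
  below-rest (here refl) = dec-false (suc a <? suc a) (<-irrefl refl)
  below-rest {+ p} (there t∈) = dec-false (p <? suc a) (<-asym (proj₁ (∈-interval⁻ (∣∣-∈-signing (interval (suc a) l) T₂∈ t∈))))
  below-rest { -[1+ n ]} (there t∈) = dec-false (lift m -[1+ n ] <? suc a) (≤⇒≯ (≤-trans (m≤m+n (suc a) l) (m≤lift-neg m n)))

suc∸index : ∀ a l j → j ≤ a → suc (suc a + l) ∸ (j + l + 1) ≡ suc (a ∸ j)
suc∸index a l j j≤a = begin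
  suc (suc a + l) ∸ (j + l + 1)     ≡⟨ cong₂ _∸_ (lhs-comm a l) (rhs-comm j l) ⟩
  l + suc (suc a) ∸ (l + suc j)     ≡⟨ [m+n]∸[m+o]≡n∸o l (suc (suc a)) (suc j) ⟩
  suc a ∸ j                         ≡⟨ +-∸-assoc 1 j≤a ⟩
  suc (a ∸ j)                       ∎
  where
  open ≡-Reasoning
  lhs-comm : ∀ a l → suc (suc a + l) ≡ l + suc (suc a)
  lhs-comm = solve-∀
  rhs-comm : ∀ j l → j + l + 1 ≡ l + suc j
  rhs-comm = solve-∀

map-∣∣-through : ∀ a l {T₁ T₂} s → T₁ ∈ signings (interval 0 a) → T₂ ∈ signings (interval (suc a) l) →
  ∣ s ∣ ≡ suc a → map ∣_∣ (T₁ ++ s ∷ T₂) ≡ interval 0 (suc a + l)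
map-∣∣-through a l {T₁} {T₂} s T₁∈ T₂∈ ∣s∣≡ =
  trans (map-++ ∣_∣ T₁ (s ∷ T₂))
  (trans (cong₂ _++_ (map-∣∣-signing (interval 0 a) T₁∈) (cong₂ _∷_ ∣s∣≡ (map-∣∣-signing (interval (suc a) l) T₂∈)))
  (sym (interval-split a l)))

countᵇ-through-+v : ∀ a l k {T₁ T₂} → T₁ ∈ signings (interval 0 a) → T₂ ∈ signings (interval (suc a) l) →
  countᵇ (lastDesB (suc a) k) (absDistinctWords (suc a + l) (T₁ ++ + suc a ∷ T₂))
    ≡ coeffA (negatives T₁ + l + 1) (suc a + l) k
countᵇ-through-+v a l k {T₁} T₁∈ T₂∈ =
  trans (Standardisation.countᵇ-lastDesB≡countᵇ-lastDesS _ _ (map-∣∣-through a l (+ suc a) T₁∈ T₂∈ refl) k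
                                                       (∈-++⁺ʳ T₁ (here refl)))
        (cong (λ r → countᵇ (lastDesS r k) (Sym (suc a + l)))
              (trans (rank-through a l T₁∈ T₂∈) (sym (suc∸index a l (negatives T₁) negatives≤a))))
  where
  negatives≤a : negatives T₁ ≤ a
  negatives≤a = subst (negatives T₁ ≤_) (length-signing (interval 0 a) T₁∈ ⟨ trans ⟩ length-interval 0 a) (negatives≤length T₁)

countᵇ-through-−v : ∀ a l k {T₁ T₂} → T₁ ∈ signings (interval 0 a) → T₂ ∈ signings (interval (suc a) l) →
  countᵇ (lastDesB (suc a) k) (absDistinctWords (suc a + l) (T₁ ++ - (+ suc a) ∷ T₂)) ≡ 0
countᵇ-through-−v a l k {T₁} {T₂} T₁∈ T₂∈ = countᵇ-lastDesB-∉ (suc a + l) k (suc a) _ +v∉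
  where
  +v∉ : + suc a ∉ T₁ ++ - (+ suc a) ∷ T₂
  +v∉ +v∈ with () ← Unique-map⇒injectiveOn ∣_∣ (T₁ ++ - (+ suc a) ∷ T₂)
                     (subst Unique (sym (map-∣∣-through a l (- (+ suc a)) T₁∈ T₂∈ refl)) (interval-unique 0 (suc a + l)))
                     +v∈ (∈-++⁺ʳ T₁ (here refl)) refl

∑-signings-through : ∀ a l k {T₁} → T₁ ∈ signings (interval 0 a) →
  ∑ (signings (suc a ∷ interval (suc a) l)) (λ T → countᵇ (lastDesB (suc a) k) (absDistinctWords (suc a + l) (T₁ ++ T)))
    ≡ 2 ^ l * coeffA (negatives T₁ + l + 1) (suc a + l) k
∑-signings-through a l k {T₁} T₁∈ = begin
  ∑ (signings (suc a ∷ interval (suc a) l)) (count ∘ (T₁ ++_))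
    ≡⟨ ∑-signings-∷ (suc a) (interval (suc a) l) (count ∘ (T₁ ++_)) ⟩
  ∑ (signings (interval (suc a) l)) (λ T₂ → count (T₁ ++ + suc a ∷ T₂))
    + ∑ (signings (interval (suc a) l)) (λ T₂ → count (T₁ ++ - (+ suc a) ∷ T₂))
    ≡⟨ cong₂ _+_ (∑-cong _ (countᵇ-through-+v a l k T₁∈)) (∑-cong _ (countᵇ-through-−v a l k T₁∈)) ⟩
  ∑ (signings (interval (suc a) l)) (λ _ → c) + ∑ (signings (interval (suc a) l)) (λ _ → 0)
    ≡⟨ cong₂ _+_ (∑-signings-const (interval (suc a) l) c) (∑-signings-const (interval (suc a) l) 0) ⟩
  2 ^ length (interval (suc a) l) * c + 2 ^ length (interval (suc a) l) * 0
    ≡⟨ cong₂ (λ n z → 2 ^ n * c + z) (length-interval (suc a) l) (*-zeroʳ (2 ^ length (interval (suc a) l))) ⟩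
  2 ^ l * c + 0
    ≡⟨ +-identityʳ (2 ^ l * c) ⟩
  2 ^ l * c
    ∎
  where
  open ≡-Reasoning
  c : ℕ
  c = coeffA (negatives T₁ + l + 1) (suc a + l) k

  count : List ℤ → ℕ
  count T = countᵇ (lastDesB (suc a) k) (absDistinctWords (suc a + l) T)

coeffB-via-signings : ∀ a l k →
  coeffB (suc l) (suc a + l) k ≡ 2 ^ l * sumTo a (λ j → (a C j) * coeffA (j + l + 1) (suc a + l) k)
coeffB-via-signings a l k = begin
  coeffB (suc l) m k
    ≡⟨ cong (λ v → countᵇ (lastDesB v k) (SignedPerms m)) (m+n∸n≡m (suc a) l) ⟩
  countᵇ (lastDesB (suc a) k) (SignedPerms m)
    ≡⟨ countᵇ-SignedPerms m (lastDesB (suc a) k) ⟩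
  ∑ (signings (range m)) count
    ≡⟨ cong (λ S → ∑ (signings S) count) (trans (range≡interval m) (interval-split a l)) ⟩
  ∑ (signings (interval 0 a ++ suc a ∷ interval (suc a) l)) count
    ≡⟨ ∑-signings-++ (interval 0 a) (suc a ∷ interval (suc a) l) count ⟩
  ∑ (signings (interval 0 a)) (λ T₁ → ∑ (signings (suc a ∷ interval (suc a) l)) (λ T → count (T₁ ++ T)))
    ≡⟨ ∑-cong (signings (interval 0 a)) (∑-signings-through a l k) ⟩
  ∑ (signings (interval 0 a)) (λ T₁ → 2 ^ l * f (negatives T₁))
    ≡⟨ ∑-*ˡ (signings (interval 0 a)) (2 ^ l) (f ∘ negatives) ⟩
  2 ^ l * ∑ (signings (interval 0 a)) (f ∘ negatives)
    ≡⟨ cong (_*_ (2 ^ l)) (∑-signings-negatives (interval 0 a) (All.tabulate (proj₁ ∘ ∈-interval⁻)) f) ⟩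
  2 ^ l * sumTo (length (interval 0 a)) (λ j → (length (interval 0 a) C j) * f j)
    ≡⟨ cong (λ n → 2 ^ l * sumTo n (λ j → (n C j) * f j)) (length-interval 0 a) ⟩
  2 ^ l * sumTo a (λ j → (a C j) * f j)
    ∎
  where
  open ≡-Reasoning
  m = suc a + l

  count : List ℤ → ℕ
  count T = countᵇ (lastDesB (suc a) k) (absDistinctWords m T)

  f : ℕ → ℕ
  f j = coeffA (j + l + 1) m k

proposition3p8 : (d l : ℕ) → l ≤ d → (k : ℕ) →
    coeffB (suc l) (suc d) k
    ≡ 2 ^ l * sumTo (d ∸ l) (λ j → ((d ∸ l) C j) * coeffA (j + l + 1) (suc d) k)
proposition3p8 d l l≤d k =
  subst (λ n → coeffB (suc l) (suc n) k ≡ 2 ^ l * sumTo (d ∸ l) (λ j → ((d ∸ l) C j) * coeffA (j + l + 1) (suc n) k))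
        (m∸n+n≡m l≤d) (coeffB-via-signings (d ∸ l) l k)
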